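{- Let $G$ be a connected $P_5$-free chordal bipartite graph with bipartition $(A,B)$ such that $|A|=|B|$ or $|A|=|B|+1$. If $c(G-S)\le|S|+1$ for every non-empty subset $S\subseteq V(G)$, then $G$ has a Hamiltonian path.
   Context: Graphs are finite, simple and undirected. A bipartite graph is chordal bipartite if every cycle of length at least six has a chord. $P_5$-free means no induced path on five vertices. For $S\subseteq V(G)$, $c(G-S)$ denotes the number of connected components of the subgraph induced on $V(G)\setminus S$. -}

module Defs where

open import Data.Nat using (ℕ; zero; suc; _+_; _≤_; _<_)
open import Data.Bool using (Bool; true; false; _∧_; _∨_; not; if_then_else_)
open import Data.Fin using (Fin; toℕ; _≟_)
open import Data.Fin.Subset using (Subset; _∈_; _∉_; ∣_∣; ∁)
open import Data.Vec using (lookup)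
open import Data.Vec.Functional using (foldr)
open import Data.Product using (Σ; _×_; _,_)
open import Relation.Nullary using (¬_; does)
open import Relation.Binary.PropositionalEquality using (_≡_)
open import Function.Definitions using (Injective)

record Graph (n : ℕ) : Set where
  field
    adj     : Fin n → Fin n → Bool
    sym     : ∀ u v → adj u v ≡ adj v u
    irrefl  : ∀ v → adj v v ≡ false
open Graph public

Adj : ∀ {n} → Graph n → Fin n → Fin n → Set
Adj G u v = adj G u v ≡ true

anyFin : ∀ {n} → (Fin n → Bool) → Bool
anyFin {n} f = foldr _∨_ false f

inS : ∀ {n} → Subset n → Fin n → Bool
inS S v = lookup S v

-- reachW G S k u v : there is a walk with at most k edges from u to v
-- in the induced subgraph G - S (all vertices of the walk outside S).
reachW : ∀ {n} → Graph n → Subset n → ℕ → Fin n → Fin n → Bool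
reachW G S zero    u v = not (inS S u) ∧ does (u ≟ v)
reachW G S (suc k) u v =
  reachW G S k u v ∨ anyFin (λ w → reachW G S k u w ∧ adj G w v ∧ not (inS S v))

-- u and v lie in the same connected component of G - S
-- (a walk of at most n edges suffices in a graph on n vertices).
reach : ∀ {n} → Graph n → Subset n → Fin n → Fin n → Bool
reach {n} G S u v = reachW G S n u v

countFin : ∀ {n} → (Fin n → Bool) → ℕ
countFin f = foldr (λ b m → if b then suc m else m) 0 f

-- c(G - S): the number of connected components of the subgraph induced on
-- V(G) \ S, computed as the number of vertices v ∉ S that are the
-- least-indexed vertex of their component.
components : ∀ {n} → Graph n → Subset n → ℕ
components {n} G S =
  countFin (λ v → not (inS S v) ∧
    not (anyFin (λ u → does (suc (toℕ u) Data.Nat.≤? toℕ v) ∧ reach G S u v)))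

∅S : ∀ {n} → Subset n
∅S = Data.Fin.Subset.⊥

Connected : ∀ {n} → Graph n → Set
Connected G = components G ∅S ≡ 1

-- (A,B) is a bipartition of G, where A = side and B = complement of side:
-- every edge joins A and B.
IsBipartition : ∀ {n} → Graph n → Subset n → Set
IsBipartition G side = ∀ u v → Adj G u v → ¬ (inS side u ≡ inS side v)

Consec : ∀ {k} → Fin k → Fin k → Set
Consec {k} i j = (suc (toℕ i) ≡ toℕ j) Data.Sum.⊎ (suc (toℕ j) ≡ toℕ i)
  Data.Sum.⊎ ((suc (toℕ i) ≡ k) × (toℕ j ≡ 0))
  Data.Sum.⊎ ((suc (toℕ j) ≡ k) × (toℕ i ≡ 0))
  where import Data.Sum

IsCycle : ∀ {n k} → Graph n → (Fin k → Fin n) → Set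
IsCycle {n} {k} G c = 3 ≤ k × Injective _≡_ _≡_ c × (∀ i j → Consec i j → Adj G (c i) (c j))

HasChord : ∀ {n k} → Graph n → (Fin k → Fin n) → Set
HasChord {n} {k} G c = Σ (Fin k) λ i → Σ (Fin k) λ j → ¬ Consec i j × ¬ (i ≡ j) × Adj G (c i) (c j)

ChordalBipartite : ∀ {n} → Graph n → Subset n → Set
ChordalBipartite {n} G side =
  IsBipartition G side × (∀ k (c : Fin k → Fin n) → 6 ≤ k → IsCycle G c → HasChord G c)

InducedP5 : ∀ {n} → Graph n → (Fin 5 → Fin n) → Set
InducedP5 G f = Injective _≡_ _≡_ f ×
  (∀ i j → (Adj G (f i) (f j) → (suc (toℕ i) ≡ toℕ j) Data.Sum.⊎ (suc (toℕ j) ≡ toℕ i))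
         × ((suc (toℕ i) ≡ toℕ j) → Adj G (f i) (f j)))
  where import Data.Sum

P5Free : ∀ {n} → Graph n → Set
P5Free {n} G = ∀ (f : Fin 5 → Fin n) → ¬ InducedP5 G f

-- Hamiltonian path: an ordering p 0, ..., p (n-1) of all vertices
-- (injective, hence bijective on Fin n) with consecutive vertices adjacent.
HamiltonianPath : ∀ {n} → Graph n → Set
HamiltonianPath {n} G = Σ (Fin n → Fin n) λ p →
  Injective _≡_ _≡_ p × (∀ i j → suc (toℕ i) ≡ toℕ j → Adj G (p i) (p j))

-- In a connected P₅-free bipartite graph two vertices on the same side have
-- a common neighbour: they are at even distance, and a shortest path of length ≥ 4 contains an induced
-- P₅. Hence the neighbourhoods of the vertices of A are totally ordered by inclusion, since
-- x ∈ N(a) ∖ N(a′), y ∈ N(a′) ∖ N(a) and a common neighbour z of a, a′ would give the induced path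
-- x a z a′ y. In such a chain graph there is a Hamiltonian path starting in A as soon as, for every
-- j < |B|, at most j vertices of A have degree ≤ j: a vertex a₀ of minimum degree has a neighbour b₀,
-- which is then adjacent to all of A, so a₀ b₀ can be put in front of a path through the rest, and the
-- degree condition survives the removal of a₀ and b₀. Finally, the degree condition follows from the
-- component bound: if j + 1 vertices of A have degree ≤ j and a₀ is one of them of largest degree d,
-- then removing S = N(a₀) isolates all of them and leaves a vertex of B besides, so
-- c(G − S) ≥ j + 2 > |S| + 1 (for d = 0, S is empty and G would be disconnected).
module Submission where

open import Defs renaming (sym to adj-sym)
open import Data.Nat using (ℕ; zero; suc; _≤_; _<_; _≥_; _+_; z≤n; s≤s; _≤?_; ≤′-refl; ≤′-step)
import Data.Nat as ℕ
open import Data.Nat.Properties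
  using (≤-refl; ≤-trans; ≤-reflexive; ≤-antisym; ≤-total; ≤-pred; ≤⇒≤′; ≰⇒>; <-irrefl; m≤n⇒m≤1+n;
         m≤m+n; m≤n+m; +-suc; +-comm; suc-injective; module ≤-Reasoning)
open import Data.Bool using (Bool; true; false; _∧_; _∨_; not)
open import Data.Bool.Properties
  using (∧-zeroʳ; ∧-comm; ∧-identityʳ; ∨-zeroʳ; ∨-identityʳ; ¬-not; not-¬; not-involutive)
  renaming (_≟_ to _≟ᵇ_)
open import Data.Fin using (Fin; zero; suc; toℕ; _≟_)
open import Data.Fin.Patterns using (0F; 1F; 2F; 3F; 4F)
open import Data.Fin.Properties using (all?; any?)
open import Data.Fin.Subset using (Subset; Nonempty; ∣_∣; ∁)
open import Data.Fin.Subset.Properties using (Empty-unique)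
open import Data.Vec using ([]; _∷_; lookup; tabulate)
open import Data.Vec.Properties using (lookup-replicate; lookup∘tabulate; lookup⇒[]=; []=⇒lookup; lookup-map)
open import Data.Sum using (_⊎_; inj₁; inj₂; [_,_]′) renaming (map to ⊎-map)
open import Data.Product using (Σ; _×_; _,_; proj₁; proj₂; uncurry)
open import Data.Empty using (⊥; ⊥-elim)
open import Data.List using (List; []; _∷_; length)
import Data.List as List
open import Data.List.Membership.Propositional.Properties using (∈-lookup)
open import Data.List.Relation.Unary.All as All using (All)
import Data.List.Relation.Unary.AllPairs as AllPairs
open import Data.List.Relation.Unary.Linked using (Linked; []; [-]; _∷_)
open import Data.List.Relation.Unary.Unique.Propositional using (Unique)
import Data.Maybe.Relation.Unary.All as Maybe
open import Function using (id; _∘_)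
open import Function.Definitions using (Injective)
open import Level using (0ℓ)
open import Relation.Nullary using (¬_; Dec; yes; no; does)
open import Relation.Nullary.Decidable using (dec-true; dec-false; toWitness; _→-dec_)
open import Relation.Binary using (Rel; Total; Transitive)
open import Relation.Binary.PropositionalEquality
  using (_≡_; _≢_; refl; sym; trans; cong; cong₂; subst; module ≡-Reasoning)

∧-elim : ∀ {a b} → a ∧ b ≡ true → a ≡ true × b ≡ true
∧-elim {true} e = refl , e

∧-intro : ∀ {a b} → a ≡ true → b ≡ true → a ∧ b ≡ true
∧-intro refl refl = refl

∨-elim : ∀ {a b} → a ∨ b ≡ true → a ≡ true ⊎ b ≡ true
∨-elim {true} _ = inj₁ refl
∨-elim {false} e = inj₂ e

∨-introʳ : ∀ a {b} → b ≡ true → a ∨ b ≡ true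
∨-introʳ a refl = ∨-zeroʳ a

not-elim : ∀ {a} → not a ≡ true → a ≡ false
not-elim {false} _ = refl

not-intro : ∀ {a} → a ≡ false → not a ≡ true
not-intro refl = refl

true≢false : ∀ {a} → a ≡ true → a ≡ false → ⊥
true≢false refl ()

¬true⇒false : ∀ {a} → ¬ a ≡ true → a ≡ false
¬true⇒false {true} h = ⊥-elim (h refl)
¬true⇒false {false} _ = refl

¬false⇒true : ∀ {a} → ¬ a ≡ false → a ≡ true
¬false⇒true {true} _ = refl
¬false⇒true {false} h = ⊥-elim (h refl)

dec-true⁻¹ : ∀ {p} {P : Set p} (P? : Dec P) → does P? ≡ true → P
dec-true⁻¹ (yes p) _ = p

1+n≰n : ∀ {m} → ¬ suc m ≤ m
1+n≰n = <-irrefl refl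

module _ {n : ℕ} where

  infixr 7 _∩_
  _∩_ : (Fin n → Bool) → (Fin n → Bool) → Fin n → Bool
  (f ∩ g) v = f v ∧ g v

  delete : Fin n → (Fin n → Bool) → Fin n → Bool
  delete x f v = f v ∧ not (does (v ≟ x))

  delete-⊆ : ∀ x f v → delete x f v ≡ true → f v ≡ true
  delete-⊆ x f v e = proj₁ (∧-elim e)

  delete-self : ∀ x f → delete x f x ≡ false
  delete-self x f rewrite dec-true (x ≟ x) refl = ∧-zeroʳ (f x)

  delete-keeps : ∀ x f v → f v ≡ true → v ≢ x → delete x f v ≡ true
  delete-keeps x f v fv v≢x = ∧-intro fv (not-intro (dec-false (v ≟ x) v≢x))

  delete-absent : ∀ x f → f x ≡ false → ∀ v → delete x f v ≡ f v
  delete-absent x f fx v with v ≟ x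
  ... | yes refl = trans (∧-zeroʳ (f v)) (sym fx)
  ... | no _ = ∧-identityʳ (f v)

  delete-∩ : ∀ x f g v → (delete x f ∩ g) v ≡ delete x (f ∩ g) v
  delete-∩ x f g v with f v
  ... | true  = ∧-comm _ (g v)
  ... | false = refl

countFin-mono : ∀ {n} (f g : Fin n → Bool) → (∀ v → f v ≡ true → g v ≡ true) → countFin f ≤ countFin g
countFin-mono {zero} f g f⊆g = z≤n
countFin-mono {suc n} f g f⊆g with f zero in f0 | g zero in g0
... | true  | true  = s≤s (countFin-mono (f ∘ suc) (g ∘ suc) (f⊆g ∘ suc))
... | true  | false = ⊥-elim (true≢false (f⊆g zero f0) g0)
... | false | true  = m≤n⇒m≤1+n (countFin-mono (f ∘ suc) (g ∘ suc) (f⊆g ∘ suc))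
... | false | false = countFin-mono (f ∘ suc) (g ∘ suc) (f⊆g ∘ suc)

countFin-cong : ∀ {n} (f g : Fin n → Bool) → (∀ v → f v ≡ g v) → countFin f ≡ countFin g
countFin-cong f g f≗g = ≤-antisym (countFin-mono f g (λ v e → trans (sym (f≗g v)) e))
                                  (countFin-mono g f (λ v e → trans (f≗g v) e))

countFin-delete : ∀ {n} (f : Fin n → Bool) x → f x ≡ true → countFin f ≡ suc (countFin (delete x f))
countFin-delete f zero fx rewrite fx =
  cong suc (countFin-cong (f ∘ suc) (delete zero f ∘ suc) (λ v → sym (∧-identityʳ (f (suc v)))))
countFin-delete f (suc x) fx with f zero
... | true  = cong suc (countFin-delete (f ∘ suc) x fx)
... | false = countFin-delete (f ∘ suc) x fx

countFin-witness : ∀ {n} (f : Fin n → Bool) → 1 ≤ countFin f → Σ (Fin n) λ v → f v ≡ true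
countFin-witness {suc n} f h with f zero in f0
... | true  = zero , f0
... | false = let v , fv = countFin-witness (f ∘ suc) h in suc v , fv

countFin-positive : ∀ {n} (f : Fin n → Bool) x → f x ≡ true → 1 ≤ countFin f
countFin-positive f x fx rewrite countFin-delete f x fx = s≤s z≤n

countFin-two : ∀ {n} (f : Fin n → Bool) x y → f x ≡ true → f y ≡ true → x ≢ y → 2 ≤ countFin f
countFin-two f x y fx fy x≢y rewrite countFin-delete f x fx =
  s≤s (countFin-positive (delete x f) y (delete-keeps x f y fy (x≢y ∘ sym)))

countFin-empty : ∀ {n} (f : Fin n → Bool) → (∀ v → f v ≡ false) → countFin f ≡ 0
countFin-empty {zero} f h = refl
countFin-empty {suc n} f h rewrite h zero = countFin-empty (f ∘ suc) (h ∘ suc)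

countFin-full : ∀ n → countFin {n} (λ _ → true) ≡ n
countFin-full zero = refl
countFin-full (suc n) = cong suc (countFin-full n)

countFin-split : ∀ {n} (f g : Fin n → Bool) → countFin f ≡ countFin (f ∩ g) + countFin (f ∩ (not ∘ g))
countFin-split {zero} f g = refl
countFin-split {suc n} f g with f zero | g zero
... | true  | true  = cong suc (countFin-split (f ∘ suc) (g ∘ suc))
... | true  | false = trans (cong suc (countFin-split (f ∘ suc) (g ∘ suc))) (sym (+-suc _ _))
... | false | _     = countFin-split (f ∘ suc) (g ∘ suc)

countFin-≤⇒⊇ : ∀ {n} (f g : Fin n → Bool) → (∀ v → f v ≡ true → g v ≡ true) → countFin g ≤ countFin f →
               ∀ v → g v ≡ true → f v ≡ true
countFin-≤⇒⊇ f g f⊆g g≤f v gv = ¬false⇒true λ fv → 1+n≰n (begin-strict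
  countFin (delete v g)  <⟨ ≤-reflexive (sym (countFin-delete g v gv)) ⟩
  countFin g             ≤⟨ g≤f ⟩
  countFin f             ≤⟨ countFin-mono f (delete v g) (f⊆g-minus-v fv) ⟩
  countFin (delete v g)  ∎)
  where
  open ≤-Reasoning
  f⊆g-minus-v : f v ≡ false → ∀ w → f w ≡ true → delete v g w ≡ true
  f⊆g-minus-v fv w fw = delete-keeps v g w (f⊆g w fw) λ { refl → true≢false fw fv }

countFin-∩-delete : ∀ {n} (U p : Fin n → Bool) x → (U ∩ p) x ≡ true →
                    countFin (U ∩ p) ≡ suc (countFin (delete x U ∩ p))
countFin-∩-delete U p x e =
  trans (countFin-delete (U ∩ p) x e) (cong suc (countFin-cong _ _ λ v → sym (delete-∩ x U p v)))

countFin-∩-delete-∉ : ∀ {n} (U p : Fin n → Bool) x → p x ≡ false → countFin (delete x U ∩ p) ≡ countFin (U ∩ p)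
countFin-∩-delete-∉ U p x px = countFin-cong _ _ λ v →
  trans (delete-∩ x U p v) (delete-absent x (U ∩ p) (trans (cong (U x ∧_) px) (∧-zeroʳ (U x))) v)

∣∣≡countFin : ∀ {n} (p : Subset n) → ∣ p ∣ ≡ countFin (lookup p)
∣∣≡countFin [] = refl
∣∣≡countFin (true ∷ p) = cong suc (∣∣≡countFin p)
∣∣≡countFin (false ∷ p) = ∣∣≡countFin p

∣∁∣≡countFin : ∀ {n} (p : Subset n) → ∣ ∁ p ∣ ≡ countFin (not ∘ lookup p)
∣∁∣≡countFin p = trans (∣∣≡countFin (∁ p)) (countFin-cong _ _ λ v → lookup-map v not p)

anyFin-elim : ∀ {n} (f : Fin n → Bool) → anyFin f ≡ true → Σ (Fin n) λ w → f w ≡ true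
anyFin-elim {suc n} f e with f zero in f0
... | true  = zero , f0
... | false = let w , fw = anyFin-elim (f ∘ suc) e in suc w , fw

anyFin-intro : ∀ {n} (f : Fin n → Bool) w → f w ≡ true → anyFin f ≡ true
anyFin-intro f zero fw rewrite fw = refl
anyFin-intro f (suc w) fw = ∨-introʳ (f zero) (anyFin-intro (f ∘ suc) w fw)

anyFin-false : ∀ {n} (f : Fin n → Bool) → (∀ w → f w ≡ false) → anyFin f ≡ false
anyFin-false {zero} f h = refl
anyFin-false {suc n} f h rewrite h zero = anyFin-false (f ∘ suc) (h ∘ suc)

optimum : ∀ {n} {R : Rel ℕ 0ℓ} → Total R → Transitive R → (P : Fin n → Bool) (h : Fin n → ℕ) →
          ∀ {w} → P w ≡ true → Σ (Fin n) λ o → P o ≡ true × (∀ v → P v ≡ true → R (h o) (h v))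
optimum {R = R} total R-trans P h {w} Pw = [ id , (λ none → ⊥-elim (true≢false Pw (none w))) ]′ (search P h)
  where
  R-refl : ∀ a → R a a
  R-refl a = [ id , id ]′ (total a a)
  search : ∀ {m} (P : Fin m → Bool) (h : Fin m → ℕ) →
           (Σ (Fin m) λ o → P o ≡ true × (∀ v → P v ≡ true → R (h o) (h v))) ⊎ (∀ v → P v ≡ false)
  search {zero} P h = inj₂ λ ()
  search {suc m} P h with search (P ∘ suc) (h ∘ suc) | P zero in P0
  ... | inj₂ none | false = inj₂ λ { zero → P0 ; (suc v) → none v }
  ... | inj₂ none | true  = inj₁ (zero , P0 , λ { zero _ → R-refl _ ; (suc v) e → ⊥-elim (true≢false e (none v)) })
  ... | inj₁ (o , Po , best) | false =
    inj₁ (suc o , Po , λ { zero e → ⊥-elim (true≢false e P0) ; (suc v) → best v })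
  ... | inj₁ (o , Po , best) | true with total (h zero) (h (suc o))
  ...   | inj₁ r = inj₁ (zero , P0 , λ { zero _ → R-refl _ ; (suc v) e → R-trans r (best v e) })
  ...   | inj₂ r = inj₁ (suc o , Po , λ { zero _ → r ; (suc v) → best v })

module _ {a} {X : Set a} where

  lookup-injective : ∀ {xs : List X} → Unique xs → ∀ i j → List.lookup xs i ≡ List.lookup xs j → i ≡ j
  lookup-injective (_ AllPairs.∷ _) zero zero _ = refl
  lookup-injective (x∉ AllPairs.∷ _) zero (suc j) x≡ = ⊥-elim (All.lookup x∉ (∈-lookup j) x≡)
  lookup-injective (x∉ AllPairs.∷ _) (suc i) zero ≡x = ⊥-elim (All.lookup x∉ (∈-lookup i) (sym ≡x))
  lookup-injective (_ AllPairs.∷ distinct) (suc i) (suc j) e = cong suc (lookup-injective distinct i j e)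

  linked-lookup : ∀ {ℓ} {R : Rel X ℓ} {xs} → Linked R xs →
                  ∀ i j → suc (toℕ i) ≡ toℕ j → R (List.lookup xs i) (List.lookup xs j)
  linked-lookup (r ∷ _) zero (suc zero) _ = r
  linked-lookup (_ ∷ rs) (suc i) (suc j) i+1≡j = linked-lookup rs i j (suc-injective i+1≡j)

  linked-∷ : ∀ {p ℓ} {P : X → Set p} {R : Rel X ℓ} {x xs} →
             Maybe.All P (List.head xs) → (∀ {y} → P y → R x y) → Linked R xs → Linked R (x ∷ xs)
  linked-∷ {xs = []} _ _ _ = [-]
  linked-∷ {xs = _ ∷ _} (Maybe.just Py) R-x rs = R-x Py ∷ rs

absent⇒All≢ : ∀ {n} {U : Fin n → Bool} {x L} → U x ≡ false → All (λ v → U v ≡ true) L → All (x ≢_) L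
absent⇒All≢ Ux = All.map λ { Uv refl → true≢false Uv Ux }

adj-flip : ∀ {n} (G : Graph n) {u v b} → adj G u v ≡ b → adj G v u ≡ b
adj-flip G {u} {v} e = trans (adj-sym G v u) e

hamiltonianPath-from-list : ∀ {n} (G : Graph n) (L : List (Fin n)) →
                            Unique L → Linked (Adj G) L → length L ≡ n → HamiltonianPath G
hamiltonianPath-from-list {n} G L distinct linked length≡n =
  subst PathOfLength length≡n (List.lookup L , (λ {i} {j} → lookup-injective distinct i j) , linked-lookup linked)
  where
  PathOfLength : ℕ → Set
  PathOfLength m = Σ (Fin m → Fin n) λ p →
    Injective _≡_ _≡_ p × (∀ i j → suc (toℕ i) ≡ toℕ j → Adj G (p i) (p j))

∅-excludes : ∀ {n} (v : Fin n) → inS (∅S {n}) v ≡ false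
∅-excludes v = lookup-replicate v false

module Walks {n} (G : Graph n) (S : Subset n) where

  walk : ℕ → Fin n → Fin n → Bool
  walk = reachW G S

  walk-last : ∀ k u v → walk (suc k) u v ≡ true →
              walk k u v ≡ true ⊎ Σ (Fin n) λ w → walk k u w ≡ true × Adj G w v × inS S v ≡ false
  walk-last k u v e with ∨-elim {walk k u v} e
  ... | inj₁ short = inj₁ short
  ... | inj₂ step =
    let w , e′ = anyFin-elim (λ w → walk k u w ∧ adj G w v ∧ not (inS S v)) step
        uw , e″ = ∧-elim e′
        wv , v∉S = ∧-elim {adj G w v} e″
    in inj₂ (w , uw , wv , not-elim v∉S)

  walk-snoc : ∀ k u w v → walk k u w ≡ true → Adj G w v → inS S v ≡ false → walk (suc k) u v ≡ true
  walk-snoc k u w v uw wv v∉S = ∨-introʳ (walk k u v)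
    (anyFin-intro (λ w → walk k u w ∧ adj G w v ∧ not (inS S v)) w (∧-intro uw (∧-intro wv (not-intro v∉S))))

  walk-suc : ∀ k u v → walk k u v ≡ true → walk (suc k) u v ≡ true
  walk-suc k u v e rewrite e = refl

  walk-mono : ∀ {k k′} u v → k ℕ.≤′ k′ → walk k u v ≡ true → walk k′ u v ≡ true
  walk-mono u v ≤′-refl e = e
  walk-mono u v (≤′-step {n = k} k≤k′) e = walk-suc k u v (walk-mono u v k≤k′ e)

  walk-nil : ∀ u → inS S u ≡ false → walk 0 u u ≡ true
  walk-nil u u∉S = ∧-intro (not-intro u∉S) (dec-true (u ≟ u) refl)

  walk-zero : ∀ u v → walk 0 u v ≡ true → u ≡ v
  walk-zero u v e = dec-true⁻¹ (u ≟ v) (proj₂ (∧-elim e))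

  walk-source : ∀ k u v → walk k u v ≡ true → inS S u ≡ false
  walk-source zero u v e = not-elim (proj₁ (∧-elim e))
  walk-source (suc k) u v e with walk-last k u v e
  ... | inj₁ short = walk-source k u v short
  ... | inj₂ (w , uw , _) = walk-source k u w uw

  walk-target : ∀ k u v → walk k u v ≡ true → inS S v ≡ false
  walk-target zero u v e with walk-zero u v e
  ... | refl = walk-source zero u v e
  walk-target (suc k) u v e with walk-last k u v e
  ... | inj₁ short = walk-target k u v short
  ... | inj₂ (_ , _ , _ , v∉S) = v∉S

  Isolated : Fin n → Set
  Isolated v = ∀ w → Adj G v w → inS S w ≡ true

  walk-to-isolated : ∀ k u v → Isolated v → walk k u v ≡ true → u ≡ v
  walk-to-isolated zero u v iso e = walk-zero u v e
  walk-to-isolated (suc k) u v iso e with walk-last k u v e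
  ... | inj₁ short = walk-to-isolated k u v iso short
  ... | inj₂ (w , uw , wv , _) = ⊥-elim (true≢false (iso w (adj-flip G wv)) (walk-target k u w uw))

  walk-from-isolated : ∀ k u v → Isolated u → walk k u v ≡ true → u ≡ v
  walk-from-isolated zero u v iso e = walk-zero u v e
  walk-from-isolated (suc k) u v iso e with walk-last k u v e
  ... | inj₁ short = walk-from-isolated k u v iso short
  ... | inj₂ (w , uw , wv , v∉S) with walk-from-isolated k u w iso uw
  ...   | refl = ⊥-elim (true≢false (iso v wv) v∉S)

  walk-++ : ∀ k m u w v → walk k u w ≡ true → walk m w v ≡ true → walk (m + k) u v ≡ true
  walk-++ k zero u w v uw wv with walk-zero w v wv
  ... | refl = uw
  walk-++ k (suc m) u w v uw wv with walk-last m w v wv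
  ... | inj₁ short = walk-suc (m + k) u v (walk-++ k m u w v uw short)
  ... | inj₂ (w′ , ww′ , w′v , v∉S) = walk-snoc (m + k) u w′ v (walk-++ k m u w w′ uw ww′) w′v v∉S

  Reachable : Fin n → Fin n → Set
  Reachable u v = Σ ℕ λ k → walk k u v ≡ true

  reachable-refl : ∀ u → inS S u ≡ false → Reachable u u
  reachable-refl u u∉S = 0 , walk-nil u u∉S

  reachable-trans : ∀ u w v → Reachable u w → Reachable w v → Reachable u v
  reachable-trans u w v (k , uw) (m , wv) = m + k , walk-++ k m u w v uw wv

  reachable-edge : ∀ u v → inS S u ≡ false → inS S v ≡ false → Adj G u v → Reachable u v
  reachable-edge u v u∉S v∉S uv = 1 , walk-snoc 0 u u v (walk-nil u u∉S) uv v∉S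

  reachable-sym : ∀ u v → Reachable u v → Reachable v u
  reachable-sym u v (k , e) = reverse k u v e
    where
    reverse : ∀ k u v → walk k u v ≡ true → Reachable v u
    reverse zero u v e with walk-zero u v e
    ... | refl = reachable-refl u (walk-source zero u u e)
    reverse (suc k) u v e with walk-last k u v e
    ... | inj₁ short = reverse k u v short
    ... | inj₂ (w , uw , wv , v∉S) =
      reachable-trans v w u (reachable-edge v w v∉S (walk-target k u w uw) (adj-flip G wv)) (reverse k u w uw)

  isRepresentative : Fin n → Bool
  isRepresentative v = not (inS S v) ∧ not (anyFin (λ u → does (suc (toℕ u) ≤? toℕ v) ∧ reach G S u v))

  representative-intro : ∀ v → inS S v ≡ false → (∀ u → reach G S u v ≡ true → toℕ v ≤ toℕ u) →
                         isRepresentative v ≡ true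
  representative-intro v v∉S least = ∧-intro (not-intro v∉S) (not-intro (anyFin-false _ λ u → ¬true⇒false λ e →
    let u<v , uv = ∧-elim e in 1+n≰n (≤-trans (dec-true⁻¹ (suc (toℕ u) ≤? toℕ v) u<v) (least u uv))))

  representative-elim : ∀ v → inS S v ≡ false → isRepresentative v ≡ false →
                        Σ (Fin n) λ u → suc (toℕ u) ≤ toℕ v × Reachable u v
  representative-elim v v∉S not-rep =
    let u , e = anyFin-elim _ (¬false⇒true λ none → true≢false (∧-intro (not-intro v∉S) (not-intro none)) not-rep)
        u<v , uv = ∧-elim e
    in u , dec-true⁻¹ (suc (toℕ u) ≤? toℕ v) u<v , n , uv

  -- Each member of I, and the least vertex outside S and I, is least in its component.
  components-≥-isolated : (I : Fin n → Bool) → (∀ v → I v ≡ true → inS S v ≡ false) →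
                          (∀ v → I v ≡ true → Isolated v) →
                          ∀ z → inS S z ≡ false → I z ≡ false → suc (countFin I) ≤ components G S
  components-≥-isolated I I∉S I-isolated z z∉S z∉I = begin
    suc (countFin I)  ≡⟨ sym count-I′ ⟩
    countFin I′       ≤⟨ countFin-mono I′ isRepresentative I′-representative ⟩
    components G S    ∎
    where
    open ≤-Reasoning
    least = optimum ≤-total ≤-trans (λ v → not (inS S v) ∧ not (I v)) toℕ (∧-intro (not-intro z∉S) (not-intro z∉I))
    m = proj₁ least
    m∉S = not-elim (proj₁ (∧-elim (proj₁ (proj₂ least))))
    m∉I = not-elim (proj₂ (∧-elim (proj₁ (proj₂ least))))
    I′ : Fin n → Bool
    I′ v = I v ∨ does (v ≟ m)
    count-I′ : countFin I′ ≡ suc (countFin I)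
    count-I′ = trans (countFin-delete I′ m (∨-introʳ (I m) (dec-true (m ≟ m) refl)))
                     (cong suc (countFin-cong (delete m I′) I I′-minus-m))
      where
      I′-minus-m : ∀ v → delete m I′ v ≡ I v
      I′-minus-m v with v ≟ m
      ... | yes refl = trans (∧-zeroʳ _) (sym m∉I)
      ... | no _ = trans (∧-identityʳ _) (∨-identityʳ (I v))
    I′-representative : ∀ v → I′ v ≡ true → isRepresentative v ≡ true
    I′-representative v I′v with ∨-elim {I v} I′v
    ... | inj₁ Iv = representative-intro v (I∉S v Iv) λ u uv →
      ≤-reflexive (cong toℕ (sym (walk-to-isolated n u v (I-isolated v Iv) uv)))
    ... | inj₂ v≡m with dec-true⁻¹ (v ≟ m) v≡m
    ...   | refl = representative-intro m m∉S minimal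
      where
      minimal : ∀ u → reach G S u m ≡ true → toℕ m ≤ toℕ u
      minimal u um with I u in Iu
      ... | true = ≤-reflexive (cong toℕ (sym (walk-from-isolated n u m (I-isolated u Iu) um)))
      ... | false = proj₂ (proj₂ least) u (∧-intro (not-intro (walk-source n u m um)) (not-intro Iu))

connected⇒reachable : ∀ {n} (G : Graph n) → Connected G → ∀ u v → Walks.Reachable G ∅S u v
connected⇒reachable {suc n} G connected u v =
  reachable-trans u zero v (reachable-sym zero u (from-zero u)) (from-zero v)
  where
  open Walks G ∅S
  zero-representative : isRepresentative zero ≡ true
  zero-representative = representative-intro zero (∅-excludes {suc n} zero) λ _ _ → z≤n
  -- With a single component, every v ≢ zero fails to be a representative and so is reached from an earlier vertex.
  from-zero : ∀ v → Reachable zero v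
  from-zero v = go (suc (toℕ v)) v ≤-refl
    where
    go : ∀ fuel v → suc (toℕ v) ≤ fuel → Reachable zero v
    go (suc fuel) v (s≤s v<fuel) with v ≟ zero | isRepresentative v in rep
    ... | yes refl | _ = reachable-refl zero (∅-excludes {suc n} zero)
    ... | no v≢0 | true = ⊥-elim (1+n≰n (≤-trans
          (countFin-two isRepresentative zero v zero-representative rep (v≢0 ∘ sym)) (≤-reflexive connected)))
    ... | no _ | false =
      let u , u<v , uv = representative-elim v (∅-excludes v) rep
      in reachable-trans zero u v (go fuel u (≤-trans u<v v<fuel)) uv

ComponentsBounded : ∀ {n} → Graph n → Set
ComponentsBounded {n} G = ∀ (S : Subset n) → Nonempty S → components G S ≤ ∣ S ∣ + 1

neighbourhood : ∀ {n} → Graph n → Fin n → Subset n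
neighbourhood G a = tabulate (adj G a)

components-without-neighbourhood : ∀ {n} (G : Graph n) → Connected G → ComponentsBounded G →
                                   ∀ a → components G (neighbourhood G a) ≤ countFin (adj G a) + 1
components-without-neighbourhood G connected bounded a with any? (λ w → adj G a w ≟ᵇ true)
... | yes (w , aw) = subst (λ s → components G S ≤ s + 1) ∣S∣≡
                       (bounded S (w , lookup⇒[]= w S (trans (lookup∘tabulate (adj G a) w) aw)))
  where
  S = neighbourhood G a
  ∣S∣≡ : ∣ S ∣ ≡ countFin (adj G a)
  ∣S∣≡ = trans (∣∣≡countFin S) (countFin-cong _ _ (lookup∘tabulate (adj G a)))
... | no none = begin
  components G (neighbourhood G a)  ≡⟨ cong (components G) (Empty-unique no-neighbour) ⟩
  components G ∅S                   ≡⟨ connected ⟩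
  1                                 ≤⟨ m≤n+m 1 _ ⟩
  countFin (adj G a) + 1            ∎
  where
  open ≤-Reasoning
  no-neighbour : ¬ Nonempty (neighbourhood G a)
  no-neighbour (w , w∈S) = none (w , trans (sym (lookup∘tabulate (adj G a) w)) ([]=⇒lookup w∈S))

path5 : ∀ {n} → Fin n → Fin n → Fin n → Fin n → Fin n → Fin 5 → Fin n
path5 v₀ v₁ v₂ v₃ v₄ 0F = v₀
path5 v₀ v₁ v₂ v₃ v₄ 1F = v₁
path5 v₀ v₁ v₂ v₃ v₄ 2F = v₂
path5 v₀ v₁ v₂ v₃ v₄ 3F = v₃
path5 v₀ v₁ v₂ v₃ v₄ 4F = v₄

consecutive : Fin 5 → Fin 5 → Bool
consecutive i j = does (suc (toℕ i) ℕ.≟ toℕ j) ∨ does (suc (toℕ j) ℕ.≟ toℕ i)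

consecutive-rows-injective : ∀ i j → (∀ k → consecutive i k ≡ consecutive j k) → i ≡ j
consecutive-rows-injective =
  toWitness {a? = all? λ i → all? λ j → all? (λ k → consecutive i k ≟ᵇ consecutive j k) →-dec (i ≟ j)} _

inducedP5-by-table : ∀ {n} (G : Graph n) (f : Fin 5 → Fin n) →
                     (∀ i j → adj G (f i) (f j) ≡ consecutive i j) → InducedP5 G f
inducedP5-by-table G f table = (λ {i} {j} fi≡fj → consecutive-rows-injective i j (same-row fi≡fj)) , λ i j →
  (λ fifj → [ inj₁ ∘ dec-true⁻¹ (_ ℕ.≟ _) , inj₂ ∘ dec-true⁻¹ (_ ℕ.≟ _) ]′
              (∨-elim (trans (sym (table i j)) fifj))) ,
  (λ i+1≡j → trans (table i j) (cong (_∨ does (suc (toℕ j) ℕ.≟ toℕ i)) (dec-true (_ ℕ.≟ _) i+1≡j)))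
  where
  same-row : ∀ {i j} → f i ≡ f j → ∀ k → consecutive i k ≡ consecutive j k
  same-row {i} {j} fi≡fj k = trans (sym (table i k)) (trans (cong (λ v → adj G v (f k)) fi≡fj) (table j k))

inducedP5 : ∀ {n} (G : Graph n) {v₀ v₁ v₂ v₃ v₄ : Fin n} →
  Adj G v₀ v₁ → Adj G v₁ v₂ → Adj G v₂ v₃ → Adj G v₃ v₄ →
  adj G v₀ v₂ ≡ false → adj G v₀ v₃ ≡ false → adj G v₀ v₄ ≡ false →
  adj G v₁ v₃ ≡ false → adj G v₁ v₄ ≡ false → adj G v₂ v₄ ≡ false →
  InducedP5 G (path5 v₀ v₁ v₂ v₃ v₄)
inducedP5 G {v₀} {v₁} {v₂} {v₃} {v₄} e₀₁ e₁₂ e₂₃ e₃₄ n₀₂ n₀₃ n₀₄ n₁₃ n₁₄ n₂₄ = inducedP5-by-table G _ table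
  where
  table : ∀ i j → adj G (path5 v₀ v₁ v₂ v₃ v₄ i) (path5 v₀ v₁ v₂ v₃ v₄ j) ≡ consecutive i j
  table 0F 0F = irrefl G v₀
  table 0F 1F = e₀₁
  table 0F 2F = n₀₂
  table 0F 3F = n₀₃
  table 0F 4F = n₀₄
  table 1F 0F = adj-flip G e₀₁
  table 1F 1F = irrefl G v₁
  table 1F 2F = e₁₂
  table 1F 3F = n₁₃
  table 1F 4F = n₁₄
  table 2F 0F = adj-flip G n₀₂
  table 2F 1F = adj-flip G e₁₂
  table 2F 2F = irrefl G v₂
  table 2F 3F = e₂₃
  table 2F 4F = n₂₄
  table 3F 0F = adj-flip G n₀₃
  table 3F 1F = adj-flip G n₁₃
  table 3F 2F = adj-flip G e₂₃
  table 3F 3F = irrefl G v₃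
  table 3F 4F = e₃₄
  table 4F 0F = adj-flip G n₀₄
  table 4F 1F = adj-flip G n₁₄
  table 4F 2F = adj-flip G n₂₄
  table 4F 3F = adj-flip G e₃₄
  table 4F 4F = irrefl G v₄

module Distance {n} (G : Graph n) (a : Fin n) where
  open Walks G ∅S

  AtDistance : ℕ → Fin n → Set
  AtDistance m v = walk m a v ≡ true × (∀ m′ → m′ < m → walk m′ a v ≡ false)

  distance : ∀ k v → walk k a v ≡ true → Σ ℕ λ m → AtDistance m v
  distance zero v e = 0 , e , λ _ ()
  distance (suc k) v e with walk k a v ≟ᵇ true
  ... | yes shorter = distance k v shorter
  ... | no not-shorter =
    suc k , e , λ { m′ (s≤s m′≤k) → ¬true⇒false λ e′ → not-shorter (walk-mono a v (≤⇒≤′ m′≤k) e′) }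

  distance-zero : ∀ v → AtDistance 0 v → a ≡ v
  distance-zero v (e , _) = walk-zero a v e

  distance-pred : ∀ m v → AtDistance (suc m) v → Σ (Fin n) λ w → Adj G w v × AtDistance m w
  distance-pred m v (e , minimal) with walk-last m a v e
  ... | inj₁ short = ⊥-elim (true≢false short (minimal m ≤-refl))
  ... | inj₂ (w , aw , wv , _) = w , wv , aw , λ m′ m′<m → ¬true⇒false λ e′ →
    true≢false (walk-snoc m′ a w v e′ wv (∅-excludes v)) (minimal (suc m′) (s≤s m′<m))

  -- The distance of y is written 2 + i + d so that concrete instances need no inequality proof.
  distance-nonadjacent : ∀ i d x y → AtDistance i x → AtDistance (2 + i + d) y → adj G x y ≡ false
  distance-nonadjacent i d x y (ax , _) (_ , minimal) = ¬true⇒false λ xy →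
    true≢false (walk-snoc i a x y ax xy (∅-excludes y)) (minimal (suc i) (s≤s (s≤s (m≤m+n i d))))

  distance-≥4⇒P5 : ∀ m v → AtDistance (4 + m) v → Σ (Fin 5 → Fin n) (InducedP5 G)
  distance-≥4⇒P5 (suc m) v d = let w , _ , dw = distance-pred (4 + m) v d in distance-≥4⇒P5 m w dw
  distance-≥4⇒P5 zero v₄ d₄ =
    let v₃ , e₃₄ , d₃ = distance-pred 3 v₄ d₄
        v₂ , e₂₃ , d₂ = distance-pred 2 v₃ d₃
        v₁ , e₁₂ , d₁ = distance-pred 1 v₂ d₂
        v₀ , e₀₁ , d₀ = distance-pred 0 v₁ d₁
    in path5 v₀ v₁ v₂ v₃ v₄ , inducedP5 G e₀₁ e₁₂ e₂₃ e₃₄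
         (distance-nonadjacent 0 0 v₀ v₂ d₀ d₂) (distance-nonadjacent 0 1 v₀ v₃ d₀ d₃)
         (distance-nonadjacent 0 2 v₀ v₄ d₀ d₄) (distance-nonadjacent 1 0 v₁ v₃ d₁ d₃)
         (distance-nonadjacent 1 1 v₁ v₄ d₁ d₄) (distance-nonadjacent 2 0 v₂ v₄ d₂ d₄)

Neighbours⊆ : ∀ {n} → Graph n → Fin n → Fin n → Set
Neighbours⊆ G a a′ = ∀ b → Adj G a b → Adj G a′ b

neighbours⊆-or-witness : ∀ {n} (G : Graph n) a a′ →
                         Neighbours⊆ G a a′ ⊎ Σ (Fin n) λ x → Adj G a x × adj G a′ x ≡ false
neighbours⊆-or-witness G a a′ with any? (λ x → (adj G a x ∧ not (adj G a′ x)) ≟ᵇ true)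
... | yes (x , e) = let ax , a′x = ∧-elim e in inj₂ (x , ax , not-elim a′x)
... | no none = inj₁ λ b ab → ¬false⇒true λ a′b → none (b , ∧-intro ab (not-intro a′b))

flips : ℕ → Bool → Bool
flips zero b = b
flips (suc m) b = not (flips m b)

module Bipartite {n} (G : Graph n) (A : Subset n) (bipartition : IsBipartition G A) where

  inA : Fin n → Bool
  inA = inS A

  opposite-sides : ∀ u v → Adj G u v → inA v ≡ not (inA u)
  opposite-sides u v uv = ¬-not λ same → bipartition u v uv (sym same)

  same-side-nonadjacent : ∀ u v → inA u ≡ inA v → adj G u v ≡ false
  same-side-nonadjacent u v same = ¬true⇒false λ uv → bipartition u v uv same

  distance-side : ∀ a m v → Distance.AtDistance G a m v → inA v ≡ flips m (inA a)
  distance-side a zero v d = cong inA (sym (Distance.distance-zero G a v d))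
  distance-side a (suc m) v d =
    let w , wv , dw = Distance.distance-pred G a m v d
    in trans (opposite-sides w v wv) (cong not (distance-side a m w dw))

  incomparable⇒P5 : ∀ {a a′ x y z} → inA a ≡ inA a′ → Adj G a x → adj G a′ x ≡ false →
                    Adj G a′ y → adj G a y ≡ false → Adj G a z → Adj G a′ z → InducedP5 G (path5 x a z a′ y)
  incomparable⇒P5 {a} {a′} {x} {y} {z} same ax a′x a′y ay az a′z =
    inducedP5 G (adj-flip G ax) az (adj-flip G a′z) a′y
      (same-side-nonadjacent x z (trans x-side (sym z-side))) (adj-flip G a′x)
      (same-side-nonadjacent x y (trans x-side (sym y-side))) (same-side-nonadjacent a a′ same) ay
      (same-side-nonadjacent z y (trans z-side (sym y-side)))
    where
    x-side : inA x ≡ not (inA a)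
    x-side = opposite-sides a x ax
    z-side : inA z ≡ not (inA a)
    z-side = opposite-sides a z az
    y-side : inA y ≡ not (inA a)
    y-side = trans (opposite-sides a′ y a′y) (cong not (sym same))

  module _ (p5-free : P5Free G) (reachable : ∀ u v → Walks.Reachable G ∅S u v) where

    common-neighbour : ∀ a a′ → a ≢ a′ → inA a ≡ inA a′ → Σ (Fin n) λ z → Adj G a z × Adj G a′ z
    common-neighbour a a′ a≢a′ same = by-distance (distance (proj₁ a⇝a′) a′ (proj₂ a⇝a′))
      where
      open Distance G a
      a⇝a′ = reachable a a′
      by-distance : Σ ℕ (λ m → AtDistance m a′) → Σ (Fin n) λ z → Adj G a z × Adj G a′ z
      by-distance (0 , d) = ⊥-elim (a≢a′ (distance-zero a′ d))
      by-distance (1 , d) = ⊥-elim (not-¬ (sym same) (distance-side a 1 a′ d))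
      by-distance (2 , d) =
        let w , wa′ , dw = distance-pred 1 a′ d
            u , uw , du = distance-pred 0 w dw
        in w , subst (λ u → Adj G u w) (sym (distance-zero u du)) uw , adj-flip G wa′
      by-distance (3 , d) =
        ⊥-elim (not-¬ (sym same) (trans (distance-side a 3 a′ d) (not-involutive (not (inA a)))))
      by-distance (suc (suc (suc (suc m))) , d) = ⊥-elim (uncurry p5-free (distance-≥4⇒P5 m a′ d))

    neighbourhoods-nested : ∀ a a′ → inA a ≡ inA a′ → Neighbours⊆ G a a′ ⊎ Neighbours⊆ G a′ a
    neighbourhoods-nested a a′ same with neighbours⊆-or-witness G a a′ | neighbours⊆-or-witness G a′ a
    ... | inj₁ a⊆a′ | _ = inj₁ a⊆a′
    ... | inj₂ _ | inj₁ a′⊆a = inj₂ a′⊆a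
    ... | inj₂ (x , ax , a′x) | inj₂ (y , a′y , ay) =
      let z , az , a′z = common-neighbour a a′ (λ { refl → true≢false ax a′x }) same
      in ⊥-elim (p5-free _ (incomparable⇒P5 same ax a′x a′y ay az a′z))

module ChainGraph {n} (G : Graph n) (A : Subset n) (bipartition : IsBipartition G A)
  (nested : ∀ a a′ → inS A a ≡ true → inS A a′ ≡ true → Neighbours⊆ G a a′ ⊎ Neighbours⊆ G a′ a) where

  open Bipartite G A bipartition using (inA; opposite-sides; same-side-nonadjacent)

  degree : (Fin n → Bool) → Fin n → ℕ
  degree U a = countFin (U ∩ adj G a)

  sizeA sizeB : (Fin n → Bool) → ℕ
  sizeA U = countFin (U ∩ inA)
  sizeB U = countFin (U ∩ (not ∘ inA))

  lowDegree : (Fin n → Bool) → ℕ → Fin n → Bool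
  lowDegree U j a = (U ∩ inA) a ∧ does (degree U a ≤? j)

  HallCondition : (Fin n → Bool) → Set
  HallCondition U = ∀ j → j < sizeB U → countFin (lowDegree U j) ≤ j

  degree-≤⇒neighbours⊆ : ∀ U a a′ → inA a ≡ true → inA a′ ≡ true → degree U a ≤ degree U a′ →
                          ∀ b → U b ≡ true → Adj G a b → Adj G a′ b
  degree-≤⇒neighbours⊆ U a a′ a∈A a′∈A a≤a′ b Ub ab with nested a a′ a∈A a′∈A
  ... | inj₁ a⊆a′ = a⊆a′ b ab
  ... | inj₂ a′⊆a = proj₂ (∧-elim (countFin-≤⇒⊇ (U ∩ adj G a′) (U ∩ adj G a)
          (λ v e → let Uv , a′v = ∧-elim e in ∧-intro Uv (a′⊆a v a′v)) a≤a′ b (∧-intro Ub ab)))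

  module RemoveMinimumDegreeEdge (U : Fin n → Bool) {k} (sizeB≡ : sizeB U ≡ suc k) (hall : HallCondition U)
                                 (A∩U-nonempty : 1 ≤ sizeA U) where

    private
      minimum = let _ , a∈ = countFin-witness (U ∩ inA) A∩U-nonempty
                in optimum ≤-total ≤-trans (U ∩ inA) (degree U) a∈

    below-sizeB : ∀ {j} → j ≤ k → j < sizeB U
    below-sizeB {j} j≤k = subst (j <_) (sym sizeB≡) (s≤s j≤k)

    a₀ : Fin n
    a₀ = proj₁ minimum

    a₀∈U∩A : (U ∩ inA) a₀ ≡ true
    a₀∈U∩A = proj₁ (proj₂ minimum)

    a₀∈A : inA a₀ ≡ true
    a₀∈A = proj₂ (∧-elim a₀∈U∩A)

    a₀-minimal : ∀ a → (U ∩ inA) a ≡ true → degree U a₀ ≤ degree U a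
    a₀-minimal = proj₂ (proj₂ minimum)

    a₀-has-neighbour : 1 ≤ degree U a₀
    a₀-has-neighbour with degree U a₀ in deg
    ... | suc _ = s≤s z≤n
    ... | zero = ⊥-elim (1+n≰n (≤-trans (countFin-positive (lowDegree U 0) a₀ a₀-low) (hall 0 (below-sizeB z≤n))))
      where
      a₀-low : lowDegree U 0 a₀ ≡ true
      a₀-low = ∧-intro a₀∈U∩A (dec-true (degree U a₀ ≤? 0) (≤-reflexive deg))

    private
      neighbour = countFin-witness (U ∩ adj G a₀) a₀-has-neighbour

    b₀ : Fin n
    b₀ = proj₁ neighbour

    b₀∈U : U b₀ ≡ true
    b₀∈U = proj₁ (∧-elim (proj₂ neighbour))

    a₀b₀ : Adj G a₀ b₀
    a₀b₀ = proj₂ (∧-elim (proj₂ neighbour))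

    b₀-universal : ∀ a → (U ∩ inA) a ≡ true → Adj G a b₀
    b₀-universal a a∈ = degree-≤⇒neighbours⊆ U a₀ a a₀∈A (proj₂ (∧-elim a∈)) (a₀-minimal a a∈) b₀ b₀∈U a₀b₀

    b₀∉A : inA b₀ ≡ false
    b₀∉A = trans (opposite-sides a₀ b₀ a₀b₀) (cong not a₀∈A)

    b₀≢a₀ : b₀ ≢ a₀
    b₀≢a₀ b₀≡a₀ = true≢false (subst (λ v → inA v ≡ true) (sym b₀≡a₀) a₀∈A) b₀∉A

    U′ : Fin n → Bool
    U′ = delete b₀ (delete a₀ U)

    U′⊆U : ∀ v → U′ v ≡ true → U v ≡ true
    U′⊆U v e = delete-⊆ a₀ U v (delete-⊆ b₀ (delete a₀ U) v e)

    a₀∉U′ : U′ a₀ ≡ false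
    a₀∉U′ = ¬true⇒false λ e → true≢false (delete-⊆ b₀ (delete a₀ U) a₀ e) (delete-self a₀ U)

    b₀∉U′ : U′ b₀ ≡ false
    b₀∉U′ = delete-self b₀ (delete a₀ U)

    b₀∈U-a₀ : delete a₀ U b₀ ≡ true
    b₀∈U-a₀ = delete-keeps a₀ U b₀ b₀∈U b₀≢a₀

    sizeA-U′ : sizeA U ≡ suc (sizeA U′)
    sizeA-U′ = trans (countFin-∩-delete U inA a₀ a₀∈U∩A)
                     (cong suc (sym (countFin-∩-delete-∉ (delete a₀ U) inA b₀ b₀∉A)))

    sizeB-U′ : sizeB U′ ≡ k
    sizeB-U′ = suc-injective (begin
      suc (sizeB U′)                        ≡⟨ sym (countFin-∩-delete (delete a₀ U) (not ∘ inA) b₀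
                                                      (∧-intro b₀∈U-a₀ (not-intro b₀∉A))) ⟩
      countFin (delete a₀ U ∩ (not ∘ inA))  ≡⟨ countFin-∩-delete-∉ U (not ∘ inA) a₀ (cong not a₀∈A) ⟩
      sizeB U                               ≡⟨ sizeB≡ ⟩
      suc k                                 ∎)
      where open ≡-Reasoning

    degree-U′ : ∀ a → (U ∩ inA) a ≡ true → degree U a ≡ suc (degree U′ a)
    degree-U′ a a∈ = begin
      degree U a                        ≡⟨ sym (countFin-∩-delete-∉ U (adj G a) a₀ a≁a₀) ⟩
      countFin (delete a₀ U ∩ adj G a)  ≡⟨ countFin-∩-delete (delete a₀ U) (adj G a) b₀
                                              (∧-intro b₀∈U-a₀ (b₀-universal a a∈)) ⟩
      suc (degree U′ a)                 ∎
      where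
      open ≡-Reasoning
      a≁a₀ : adj G a a₀ ≡ false
      a≁a₀ = same-side-nonadjacent a a₀ (trans (proj₂ (∧-elim a∈)) (sym a₀∈A))

    lowDegree-U′ : ∀ j a → lowDegree U′ j a ≡ true → a ≢ a₀ × lowDegree U (suc j) a ≡ true
    lowDegree-U′ j a low′ =
      let U′a , a∈A = ∧-elim (proj₁ (∧-elim low′))
          a∈U∩A = ∧-intro (U′⊆U a U′a) a∈A
          deg′ = dec-true⁻¹ (_ ≤? _) (proj₂ (∧-elim low′))
      in (λ { refl → true≢false U′a a₀∉U′ }) ,
         ∧-intro a∈U∩A (dec-true (_ ≤? _) (subst (_≤ suc j) (sym (degree-U′ a a∈U∩A)) (s≤s deg′)))

    lowDegree-a₀ : ∀ j a → lowDegree U j a ≡ true → lowDegree U j a₀ ≡ true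
    lowDegree-a₀ j a low = let a∈U∩A , deg = ∧-elim low in
      ∧-intro a₀∈U∩A (dec-true (_ ≤? _) (≤-trans (a₀-minimal a a∈U∩A) (dec-true⁻¹ (_ ≤? _) deg)))

    hall-U′ : HallCondition U′
    hall-U′ j j<k with lowDegree U (suc j) a₀ in a₀-low
    ... | false = ≤-trans (≤-reflexive (countFin-empty (lowDegree U′ j) λ a → ¬true⇒false λ low′ →
                    true≢false (lowDegree-a₀ (suc j) a (proj₂ (lowDegree-U′ j a low′))) a₀-low)) z≤n
    ... | true = ≤-pred (begin
      suc (countFin (lowDegree U′ j))                   ≤⟨ s≤s (countFin-mono _ _ low′⇒low-a₀) ⟩
      suc (countFin (delete a₀ (lowDegree U (suc j))))  ≡⟨ sym (countFin-delete (lowDegree U (suc j)) a₀ a₀-low) ⟩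
      countFin (lowDegree U (suc j))                    ≤⟨ hall (suc j) (below-sizeB (subst (j <_) sizeB-U′ j<k)) ⟩
      suc j                                             ∎)
      where
      open ≤-Reasoning
      low′⇒low-a₀ : ∀ a → lowDegree U′ j a ≡ true → delete a₀ (lowDegree U (suc j)) a ≡ true
      low′⇒low-a₀ a low′ =
        let a≢a₀ , low = lowDegree-U′ j a low′ in delete-keeps a₀ (lowDegree U (suc j)) a low a≢a₀

  record PathThrough (U : Fin n → Bool) : Set where
    field
      vertices  : List (Fin n)
      distinct  : Unique vertices
      within    : All (λ v → U v ≡ true) vertices
      covers    : length vertices ≡ sizeA U + sizeB U
      linked    : Linked (Adj G) vertices
      startsInA : Maybe.All (λ v → (U ∩ inA) v ≡ true) (List.head vertices)

  pathThrough : ∀ k U → sizeB U ≡ k → sizeA U ≡ k ⊎ sizeA U ≡ suc k → HallCondition U → PathThrough U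
  pathThrough zero U sizeB≡0 (inj₁ sizeA≡0) _ = record
    { vertices = [] ; distinct = AllPairs.[] ; within = All.[] ; covers = sym (cong₂ _+_ sizeA≡0 sizeB≡0)
    ; linked = [] ; startsInA = Maybe.nothing }
  pathThrough zero U sizeB≡0 (inj₂ sizeA≡1) _ =
    let a , a∈U∩A = countFin-witness (U ∩ inA) (≤-reflexive (sym sizeA≡1)) in record
    { vertices = a ∷ [] ; distinct = All.[] AllPairs.∷ AllPairs.[] ; within = proj₁ (∧-elim a∈U∩A) All.∷ All.[]
    ; covers = sym (cong₂ _+_ sizeA≡1 sizeB≡0) ; linked = [-] ; startsInA = Maybe.just a∈U∩A }
  pathThrough (suc k) U sizeB≡ sizeA≡ hall = record
    { vertices = a₀ ∷ b₀ ∷ vertices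
    ; distinct = ((b₀≢a₀ ∘ sym) All.∷ absent⇒All≢ a₀∉U′ within)
                 AllPairs.∷ (absent⇒All≢ b₀∉U′ within AllPairs.∷ distinct)
    ; within = proj₁ (∧-elim a₀∈U∩A) All.∷ b₀∈U All.∷ All.map (U′⊆U _) within
    ; covers = covers′
    ; linked = a₀b₀ ∷ linked-∷ startsInA b₀→A∩U′ linked
    ; startsInA = Maybe.just a₀∈U∩A }
    where
    A∩U-nonempty : 1 ≤ sizeA U
    A∩U-nonempty = [ (λ e → subst (1 ≤_) (sym e) (s≤s z≤n)) , (λ e → subst (1 ≤_) (sym e) (s≤s z≤n)) ]′ sizeA≡
    open RemoveMinimumDegreeEdge U sizeB≡ hall A∩U-nonempty
    sizeA≡′ : sizeA U′ ≡ k ⊎ sizeA U′ ≡ suc k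
    sizeA≡′ = ⊎-map (λ e → suc-injective (trans (sym sizeA-U′) e))
                    (λ e → suc-injective (trans (sym sizeA-U′) e)) sizeA≡
    open PathThrough (pathThrough k U′ sizeB-U′ sizeA≡′ hall-U′)
    b₀→A∩U′ : ∀ {a} → (U′ ∩ inA) a ≡ true → Adj G b₀ a
    b₀→A∩U′ {a} a∈ = let U′a , a∈A = ∧-elim a∈ in adj-flip G (b₀-universal a (∧-intro (U′⊆U a U′a) a∈A))
    covers′ : suc (suc (length vertices)) ≡ sizeA U + sizeB U
    covers′ = begin
      suc (suc (length vertices))      ≡⟨ cong (λ m → suc (suc m)) covers ⟩
      suc (suc (sizeA U′ + sizeB U′))  ≡⟨ cong suc (sym (+-suc _ _)) ⟩
      suc (sizeA U′) + suc (sizeB U′)  ≡⟨ cong₂ _+_ (sym sizeA-U′) (trans (cong suc sizeB-U′) (sym sizeB≡)) ⟩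
      sizeA U + sizeB U                ∎
      where open ≡-Reasoning

  full : Fin n → Bool
  full _ = true

  hamiltonianPath : ∣ A ∣ ≡ ∣ ∁ A ∣ ⊎ ∣ A ∣ ≡ suc ∣ ∁ A ∣ → HallCondition full → HamiltonianPath G
  hamiltonianPath balanced hall = hamiltonianPath-from-list G vertices distinct linked (trans covers sizes)
    where
    balanced′ : sizeA full ≡ sizeB full ⊎ sizeA full ≡ suc (sizeB full)
    balanced′ = ⊎-map (λ e → trans (sym (∣∣≡countFin A)) (trans e (∣∁∣≡countFin A)))
                      (λ e → trans (sym (∣∣≡countFin A)) (trans e (cong suc (∣∁∣≡countFin A)))) balanced
    open PathThrough (pathThrough (sizeB full) full refl balanced′ hall)
    sizes : sizeA full + sizeB full ≡ n
    sizes = trans (sym (countFin-split full inA)) (countFin-full n)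

  non-neighbour-in-B : ∀ a → degree full a < sizeB full → Σ (Fin n) λ z → inA z ≡ false × adj G a z ≡ false
  non-neighbour-in-B a small with any? (λ z → (not (inA z) ∧ not (adj G a z)) ≟ᵇ true)
  ... | yes (z , e) = let z∉A , az = ∧-elim e in z , not-elim z∉A , not-elim az
  ... | no none = ⊥-elim (1+n≰n (≤-trans small (countFin-mono (full ∩ (not ∘ inA)) (adj G a) B⊆N)))
    where
    B⊆N : ∀ z → not (inA z) ≡ true → adj G a z ≡ true
    B⊆N z z∉A = ¬false⇒true λ az → none (z , ∧-intro z∉A (not-intro az))

  hall-from-component-bound : Connected G → ComponentsBounded G → HallCondition full
  hall-from-component-bound connected bounded j j<B with countFin (lowDegree full j) ≤? j
  ... | yes few = few
  ... | no many = ⊥-elim (1+n≰n (begin-strict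
    components G S        ≤⟨ components-without-neighbourhood G connected bounded a₀ ⟩
    degree full a₀ + 1    ≡⟨ +-comm (degree full a₀) 1 ⟩
    suc (degree full a₀)  ≤⟨ s≤s a₀-low ⟩
    suc j                 ≤⟨ ≰⇒> many ⟩
    countFin F            <⟨ ≤-refl ⟩
    suc (countFin F)      ≤⟨ components-≥-isolated F F∉S F-isolated z z∉S z∉F ⟩
    components G S        ∎))
    where
    open ≤-Reasoning
    F = lowDegree full j
    maximum = let a , a∈F = countFin-witness F (≤-trans (s≤s z≤n) (≰⇒> many))
              in optimum {R = _≥_} (λ x y → ≤-total y x) (λ x≥y y≥z → ≤-trans y≥z x≥y) F (degree full) a∈F
    a₀ = proj₁ maximum
    a₀∈A = proj₁ (∧-elim (proj₁ (proj₂ maximum)))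
    a₀-low = dec-true⁻¹ (_ ≤? _) (proj₂ (∧-elim (proj₁ (proj₂ maximum))))
    S = neighbourhood G a₀
    open Walks G S using (Isolated; components-≥-isolated)
    inS-S : ∀ v → inS S v ≡ adj G a₀ v
    inS-S = lookup∘tabulate (adj G a₀)
    F⊆A : ∀ a → F a ≡ true → inA a ≡ true
    F⊆A a Fa = proj₁ (∧-elim Fa)
    F∉S : ∀ a → F a ≡ true → inS S a ≡ false
    F∉S a Fa = trans (inS-S a) (same-side-nonadjacent a₀ a (trans a₀∈A (sym (F⊆A a Fa))))
    F-isolated : ∀ a → F a ≡ true → Isolated a
    F-isolated a Fa b ab = trans (inS-S b)
      (degree-≤⇒neighbours⊆ full a a₀ (F⊆A a Fa) a₀∈A (proj₂ (proj₂ maximum) a Fa) b refl ab)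
    non-neighbour = non-neighbour-in-B a₀ (≤-trans (s≤s a₀-low) j<B)
    z = proj₁ non-neighbour
    z∉S = trans (inS-S z) (proj₂ (proj₂ non-neighbour))
    z∉F = cong (_∧ does (degree full z ≤? j)) (proj₁ (proj₂ non-neighbour))

theorem6 : ∀ {n} (G : Graph n) (side : Subset n) →
    Connected G → P5Free G → ChordalBipartite G side →
    (∣ side ∣ ≡ ∣ ∁ side ∣ ⊎ ∣ side ∣ ≡ suc ∣ ∁ side ∣) →
    (∀ (S : Subset n) → Nonempty S → components G S ≤ ∣ S ∣ + 1) →
    HamiltonianPath G
theorem6 G side connected p5-free (bipartition , _) balanced bounded =
  hamiltonianPath balanced (hall-from-component-bound connected bounded)
  where
  open Bipartite G side bipartition using (neighbourhoods-nested)
  nested : ∀ a a′ → inS side a ≡ true → inS side a′ ≡ true → Neighbours⊆ G a a′ ⊎ Neighbours⊆ G a′ a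
  nested a a′ a∈A a′∈A =
    neighbourhoods-nested p5-free (connected⇒reachable G connected) a a′ (trans a∈A (sym a′∈A))
  open ChainGraph G side bipartition nested
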